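{- Let $n\ge 1$ and let $F:S_n\to S_n$ be a homing shuffle. Then for every $w\in S_n$ there is some $m<2^{n-1}$ such that $F$ terminates after $m$ iterations on $w$. In other words, $\operatorname{tn} F<2^{n-1}$.
   Context: $[n]=\{1,\dots,n\}$ and $S_n$ is the group of bijections $[n]\to[n]$, with product $(ab)(i)=a(b(i))$. A homing shuffle is a map $F:S_n\to S_n$ such that for every $w\in S_n$, setting $k:=w(1)$: (a) $F(w)(k)=k$, and (b) $F(w)(i)=w(i)$ for all $i>k$. $F^m$ denotes the $m$-th iterate of $F$ ($F^0$ the identity map). $F$ terminates after $m$ iterations on $w$ if $F^m(w)(1)=1$. The termination number $\operatorname{tn}F$ is the smallest $m\in\mathbb{N}$ such that $F^m(w)(1)=1$ for all $w\in S_n$. -}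

module Defs where

open import Data.Nat using (ℕ; zero; suc)
open import Data.Fin using (Fin; _<_)
open import Data.Fin.Permutation using (Permutation′; _⟨$⟩ʳ_)
open import Relation.Binary.PropositionalEquality using (_≡_)

-- S_n is modelled as Permutation′ n (bijections Fin n ↔ Fin n);
-- the element i ∈ [n] is represented by Fin n with 1 ↦ zero (order preserved).

IsHomingShuffle : ∀ {n} → (Permutation′ (suc n) → Permutation′ (suc n)) → Set
IsHomingShuffle {n} F =
  ∀ (w : Permutation′ (suc n)) →
    (F w ⟨$⟩ʳ (w ⟨$⟩ʳ Fin.zero) ≡ w ⟨$⟩ʳ Fin.zero)
    × (∀ (i : Fin (suc n)) → w ⟨$⟩ʳ Fin.zero < i → F w ⟨$⟩ʳ i ≡ w ⟨$⟩ʳ i)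
  where open import Data.Product using (_×_)

iter : ∀ {A : Set} → (A → A) → ℕ → A → A
iter F zero    x = x
iter F (suc m) x = F (iter F m x)

TerminatesAfter : ∀ {n} → (Permutation′ (suc n) → Permutation′ (suc n))
                  → ℕ → Permutation′ (suc n) → Set
TerminatesAfter F m w = iter F m w ⟨$⟩ʳ Fin.zero ≡ Fin.zero

-- Record which of the positions 2, …, n+1 a permutation fixes, and read this set as a binary
-- number whose most significant bit is position n+1.  If w(1) = k ≠ 1, one homing step fixes k,
-- which w did not fix, and leaves every position above k untouched: the number strictly
-- increases.  Being below 2^n, it can increase fewer than 2^n times.
module Submission where

open import Defs
open import Data.Nat using (ℕ; suc; _<_; _^_)
open import Data.Product using (∃; _×_)
open import Data.Fin.Permutation using (Permutation′)

open import Data.Nat using (zero; _+_; _*_; _≤_; z≤n; s≤s)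
open import Data.Nat.Properties
open import Data.Fin using (Fin) renaming (zero to fzero; suc to fsuc; _<_ to _<ᶠ_)
open import Data.Fin.Properties using () renaming (_≟_ to _≟ᶠ_; 0≢1+n to 0≢1+nᶠ)
open import Data.Fin.Permutation using (_⟨$⟩ʳ_; _⟨$⟩ˡ_; inverseˡ)
open import Data.Bool using (Bool; true; false)
open import Data.Product using (_,_; proj₁; proj₂)
open import Relation.Nullary using (yes; no; does; ¬_; contradiction)
open import Relation.Nullary.Decidable using (dec-true; dec-false)
open import Level using (0ℓ)
open import Relation.Unary using (Pred; Decidable)
open import Relation.Binary.PropositionalEquality

iter-suc : ∀ {A : Set} (f : A → A) m x → iter f m (f x) ≡ iter f (suc m) x
iter-suc f zero    x = refl
iter-suc f (suc m) x = cong f (iter-suc f m x)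

module _ {A : Set} (f : A → A) {Done : Pred A 0ℓ} (done? : Decidable Done)
         (V : A → ℕ) (V-increases : ∀ x → ¬ Done x → V x < V (f x))
         (B : ℕ) (V<B : ∀ x → V x < B) where

  terminates-within-bound : ∀ x → ∃ λ m → m + V x < B × Done (iter f m x)
  terminates-within-bound x = fueled B x (m≤m+n B (V x))
    where
    1+d+Vx≤d+Vfx : ∀ d {x} → ¬ Done x → suc d + V x ≤ d + V (f x)
    1+d+Vx≤d+Vfx d {x} ¬Dx = ≤-trans (≤-reflexive (sym (+-suc d (V x)))) (+-monoʳ-≤ d (V-increases x ¬Dx))

    fueled : ∀ d x → B ≤ d + V x → ∃ λ m → m + V x < B × Done (iter f m x)
    fueled zero    x B≤Vx = contradiction B≤Vx (<⇒≱ (V<B x))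
    fueled (suc d) x B≤1+d+Vx with done? x
    ... | yes Dx = 0 , V<B x , Dx
    ... | no ¬Dx with fueled d (f x) (≤-trans B≤1+d+Vx (1+d+Vx≤d+Vfx d ¬Dx))
    ...   | m , m+Vfx<B , Dm =
      suc m , ≤-trans (s≤s (1+d+Vx≤d+Vfx m ¬Dx)) m+Vfx<B , subst Done (iter-suc f m x) Dm

bit : Bool → ℕ
bit true  = 1
bit false = 0

bit≤1 : ∀ b → bit b ≤ 1
bit≤1 true  = s≤s z≤n
bit≤1 false = z≤n

binary : ∀ {n} → (Fin n → Bool) → ℕ
binary {zero}  b = 0
binary {suc n} b = bit (b fzero) + 2 * binary (λ i → b (fsuc i))

binary-cong : ∀ {n} {b b′ : Fin n → Bool} → (∀ i → b i ≡ b′ i) → binary b ≡ binary b′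
binary-cong {zero}  e = refl
binary-cong {suc n} e = cong₂ (λ x y → bit x + 2 * y) (e fzero) (binary-cong (λ i → e (fsuc i)))

digit+2*-< : ∀ x y {a c} → x ≤ 1 → a < c → x + 2 * a < y + 2 * c
digit+2*-< x y {a} {c} x≤1 a<c = begin-strict
  x + 2 * a   ≤⟨ +-monoˡ-≤ (2 * a) x≤1 ⟩
  1 + 2 * a   <⟨ n<1+n _ ⟩
  2 + 2 * a   ≡⟨ sym (*-suc 2 a) ⟩
  2 * suc a   ≤⟨ *-monoʳ-≤ 2 a<c ⟩
  2 * c       ≤⟨ m≤n+m (2 * c) y ⟩
  y + 2 * c   ∎
  where open ≤-Reasoning

binary<2^n : ∀ {n} (b : Fin n → Bool) → binary b < 2 ^ n
binary<2^n {zero}  b = s≤s z≤n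
binary<2^n {suc n} b = digit+2*-< (bit (b fzero)) 0 (bit≤1 _) (binary<2^n (λ i → b (fsuc i)))

binary-<-at-highest-difference : ∀ {n} {b b′ : Fin n → Bool} (j : Fin n) →
  b j ≡ false → b′ j ≡ true → (∀ i → j <ᶠ i → b i ≡ b′ i) → binary b < binary b′
binary-<-at-highest-difference {b = b} {b′} fzero bj b′j agree rewrite bj | b′j =
  s≤s (≤-reflexive (cong (2 *_) (binary-cong (λ i → agree (fsuc i) (s≤s z≤n)))))
binary-<-at-highest-difference {b = b} {b′} (fsuc j) bj b′j agree =
  digit+2*-< (bit (b fzero)) (bit (b′ fzero)) (bit≤1 _)
    (binary-<-at-highest-difference j bj b′j (λ i j<i → agree (fsuc i) (s≤s j<i)))

fixes? : ∀ {n} → Permutation′ n → Fin n → Bool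
fixes? w i = does (w ⟨$⟩ʳ i ≟ᶠ i)

module _ {n : ℕ} (F : Permutation′ (suc n) → Permutation′ (suc n)) (homing : IsHomingShuffle F) where

  potential : Permutation′ (suc n) → ℕ
  potential w = binary (λ j → fixes? w (fsuc j))

  potential<2^n : ∀ w → potential w < 2 ^ n
  potential<2^n w = binary<2^n (λ j → fixes? w (fsuc j))

  potential-increases : ∀ w → ¬ w ⟨$⟩ʳ fzero ≡ fzero → potential w < potential (F w)
  potential-increases w w1≢1 with w ⟨$⟩ʳ fzero in w1≡k
  ... | fzero  = contradiction refl w1≢1
  ... | fsuc j = binary-<-at-highest-difference j k-unfixed k-fixed above-k-unchanged
    where
    k-unfixed : fixes? w (fsuc j) ≡ false
    k-unfixed = dec-false (_ ≟ᶠ _) λ wk≡k → 0≢1+nᶠ (begin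
      fzero                        ≡⟨ sym (inverseˡ w) ⟩
      w ⟨$⟩ˡ (w ⟨$⟩ʳ fzero)        ≡⟨ cong (w ⟨$⟩ˡ_) (trans w1≡k (sym wk≡k)) ⟩
      w ⟨$⟩ˡ (w ⟨$⟩ʳ fsuc j)       ≡⟨ inverseˡ w ⟩
      fsuc j                       ∎)
      where open ≡-Reasoning

    k-fixed : fixes? (F w) (fsuc j) ≡ true
    k-fixed = dec-true (_ ≟ᶠ _) (subst (λ k → F w ⟨$⟩ʳ k ≡ k) w1≡k (proj₁ (homing w)))

    above-k-unchanged : ∀ i → j <ᶠ i → fixes? w (fsuc i) ≡ fixes? (F w) (fsuc i)
    above-k-unchanged i j<i
      rewrite proj₂ (homing w) (fsuc i) (subst (_<ᶠ fsuc i) (sym w1≡k) (s≤s j<i)) = refl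

theorem2 : (n : ℕ) → (F : Permutation′ (suc n) → Permutation′ (suc n))
           → IsHomingShuffle F
           → (w : Permutation′ (suc n))
           → ∃ λ m → m < 2 ^ n × TerminatesAfter F m w
theorem2 n F homing w
  with terminates-within-bound F (λ v → v ⟨$⟩ʳ fzero ≟ᶠ fzero)
         (potential F homing) (potential-increases F homing)
         (2 ^ n) (potential<2^n F homing) w
... | m , m+V<2^n , terminated = m , m+n≤o⇒m≤o (suc m) m+V<2^n , terminated
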